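{- Let $G\in\mathscr{T}$ consist of $n$ triangles. For any maximum independent set $S$ of $G$, the graph $G\setminus S$ is bipartite.
   Context: $\mathscr{T}$ is the class of simple graphs constructed as follows: take an even number of vertex-disjoint triangles (the set of triangle edges is $E_1(G)$), and then add edges (the set $E_2(G)$) so that every vertex of each triangle is joined by exactly one added edge to a vertex of a different triangle, yielding a 3-regular graph. $G\setminus S$ denotes the subgraph obtained by deleting the vertices of $S$. -}

module Defs where

open import Data.Nat using (ℕ; _*_; _≤_)
open import Data.Fin using (Fin; quotient)
open import Data.Fin.Subset using (Subset; _∈_; _∉_; ∣_∣)
open import Data.Bool using (Bool)
open import Data.Empty using (⊥)
open import Data.Product using (_×_; ∃)
open import Relation.Binary.PropositionalEquality using (_≡_; _≢_)

-- Vertex set: Fin (n * 3); vertex v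
-- lies in triangle  tri v = quotient 3 v  (the vertices of triangle i are
-- combine i 0, combine i 1, combine i 2).  The added edges E₂ form a perfect
-- matching given by a fixed-point-free involution M ("every vertex is joined by
-- exactly one added edge") whose partner always lies in a different triangle.
record TGraph (n : ℕ) : Set where
  field
    even    : ∃ λ k → n ≡ 2 * k
    M       : Fin (n * 3) → Fin (n * 3)
    M-invol : ∀ v → M (M v) ≡ v
    M-other : ∀ v → quotient 3 (M (v)) ≢ quotient {n} 3 v

  tri : Fin (n * 3) → Fin n
  tri = quotient 3

  data Adj (u v : Fin (n * 3)) : Set where
    tri-edge   : tri u ≡ tri v → u ≢ v → Adj u v
    match-edge : M u ≡ v → Adj u v

  Independent : Subset (n * 3) → Set
  Independent S = ∀ u v → u ∈ S → v ∈ S → Adj u v → ⊥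

  MaximumIndependent : Subset (n * 3) → Set
  MaximumIndependent S = Independent S × (∀ T → Independent T → ∣ T ∣ ≤ ∣ S ∣)

  BipartiteMinus : Subset (n * 3) → Set
  BipartiteMinus S = ∃ λ (c : Fin (n * 3) → Bool) →
    ∀ u v → u ∉ S → v ∉ S → Adj u v → c u ≢ c v

-- Deleting one vertex from every triangle of a graph in 𝒯 leaves each surviving
-- vertex with exactly one surviving triangle neighbour and at most one surviving
-- matching neighbour: what remains is the union of two matchings, hence
-- bipartite. Applied to an arbitrary choice of deleted vertices, one colour class
-- of the survivors is an independent set meeting every triangle, so α(G) ≥ n.
-- An independent set meets each triangle at most once, so a maximum one meets
-- every triangle exactly once, and G ∖ S is again such a union of two matchings.
module Submission where

open import Data.Bool using (Bool; true; false; not)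
open import Data.Bool.Properties using (not-¬; not-involutive) renaming (_≟_ to _≟ᴮ_)
open import Data.Empty using (⊥-elim)
open import Data.Fin using (Fin; zero; suc; _≟_; combine; remainder)
open import Data.Fin.Patterns using (0F; 1F; 2F)
open import Data.Fin.Properties
  using (all?; suc-injective; remQuot-combine; combine-remQuot; combine-injectiveʳ)
open import Data.Fin.Subset
  using (Subset; inside; outside; _∈_; _∉_; _-_; ⁅_⁆; ∣_∣; Nonempty; Empty)
open import Data.Fin.Subset.Properties
  using ( nonempty?; ∣p∣≤∣x∷p∣; ∣p─q∣≤∣p∣; x∈p⇒∣p-x∣<∣p∣; x∈p∧x≢y⇒x∈p-y; p─q⊆p
        ; Empty-unique; ∣⊥∣≡0 )
open import Data.Maybe using (Maybe; just; nothing; maybe; _>>=_)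
open import Data.Maybe.Properties using (just-injective)
open import Data.Nat using (ℕ; zero; suc; _*_; _+_; _≤_; _<_; z≤n; s≤s)
open import Data.Nat.Induction using (<-wellFounded)
open import Data.Nat.Properties using (≤-reflexive; ≤-trans; ≤-<-trans; +-mono-≤; +-mono-≤-<; <⇒≱)
open import Data.Product using (∃; _×_; _,_; proj₁; proj₂)
open import Data.Vec using ([]; _∷_; _++_; lookup; tabulate; here; there)
open import Data.Vec.Properties using (lookup∘tabulate; lookup⇒[]=; []=⇒lookup)
open import Function using (_∘_; const)
open import Induction.WellFounded using (Acc; acc)
open import Relation.Nullary using (yes; no; does; ¬?; contradiction)
open import Relation.Nullary.Decidable
  using (toWitness; dec-true; decidable-stable; _→-dec_; _×-dec_)
open import Relation.Unary using (Pred; Decidable)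
open import Relation.Binary.PropositionalEquality
  using (_≡_; _≢_; refl; sym; trans; cong; cong₂; subst; ≢-sym; module ≡-Reasoning)

open import Defs

other : Fin 3 → Fin 3 → Fin 3
other 0F 1F = 2F
other 0F 2F = 1F
other 1F 0F = 2F
other 1F 2F = 0F
other 2F 0F = 1F
other 2F 1F = 0F
other j  _  = j

other-≢ˡ : ∀ j k → j ≢ k → other j k ≢ j
other-≢ˡ = toWitness {a? = all? λ j → all? λ k → ¬? (j ≟ k) →-dec ¬? (other j k ≟ j)} _

other-≢ʳ : ∀ j k → j ≢ k → other j k ≢ k
other-≢ʳ = toWitness {a? = all? λ j → all? λ k → ¬? (j ≟ k) →-dec ¬? (other j k ≟ k)} _

other-unique : ∀ j k l → j ≢ k → l ≢ j → l ≢ k → l ≡ other j k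
other-unique = toWitness {a? = all? λ j → all? λ k → all? λ l →
  ¬? (j ≟ k) →-dec ¬? (l ≟ j) →-dec ¬? (l ≟ k) →-dec l ≟ other j k} _

other-involutive : ∀ j k → j ≢ k → other (other j k) k ≡ j
other-involutive j k j≢k =
  sym (other-unique (other j k) k j (other-≢ʳ j k j≢k) (≢-sym (other-≢ˡ j k j≢k)) j≢k)

subsetOf : ∀ {N ℓ} {P : Pred (Fin N) ℓ} → Decidable P → Subset N
subsetOf P? = tabulate (does ∘ P?)

module _ {N ℓ} {P : Pred (Fin N) ℓ} (P? : Decidable P) where

  ∈-subsetOf⁺ : ∀ {v} → P v → v ∈ subsetOf P?
  ∈-subsetOf⁺ {v} pv =
    lookup⇒[]= v _ (trans (lookup∘tabulate (does ∘ P?) v) (dec-true (P? v) pv))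

  ∈-subsetOf⁻ : ∀ {v} → v ∈ subsetOf P? → P v
  ∈-subsetOf⁻ {v} v∈ with P? v | trans (sym (lookup∘tabulate (does ∘ P?) v)) ([]=⇒lookup v∈)
  ... | yes pv | _  = pv
  ... | no _   | ()

x∉p-x : ∀ {N} (p : Subset N) x → x ∉ p - x
x∉p-x (_ ∷ p) zero    ()
x∉p-x (_ ∷ p) (suc x) (there x∈) = x∉p-x p x x∈

∣p++q∣≡∣p∣+∣q∣ : ∀ {m n} (p : Subset m) (q : Subset n) → ∣ p ++ q ∣ ≡ ∣ p ∣ + ∣ q ∣
∣p++q∣≡∣p∣+∣q∣ []            q = refl
∣p++q∣≡∣p∣+∣q∣ (outside ∷ p) q = ∣p++q∣≡∣p∣+∣q∣ p q
∣p++q∣≡∣p∣+∣q∣ (inside  ∷ p) q = cong suc (∣p++q∣≡∣p∣+∣q∣ p q)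

x∈p⇒1≤∣p∣ : ∀ {N} {p : Subset N} {x} → x ∈ p → 1 ≤ ∣ p ∣
x∈p⇒1≤∣p∣ here                     = s≤s z≤n
x∈p⇒1≤∣p∣ {p = s ∷ p} (there x∈p) = ≤-trans (x∈p⇒1≤∣p∣ x∈p) (∣p∣≤∣x∷p∣ s p)

Empty⇒∣p∣≡0 : ∀ {N} {p : Subset N} → Empty p → ∣ p ∣ ≡ 0
Empty⇒∣p∣≡0 {N} empty = trans (cong ∣_∣ (Empty-unique empty)) (∣⊥∣≡0 N)

∣p∣≤1 : ∀ {N} {p : Subset N} → (∀ {x y} → x ∈ p → y ∈ p → x ≡ y) → ∣ p ∣ ≤ 1
∣p∣≤1 {p = []}          _    = z≤n
∣p∣≤1 {p = outside ∷ p} same = ∣p∣≤1 λ x∈ y∈ → suc-injective (same (there x∈) (there y∈))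
∣p∣≤1 {p = inside  ∷ p} same =
  s≤s (≤-reflexive (Empty⇒∣p∣≡0 λ (x , x∈) → contradiction (same here (there x∈)) λ ()))

record TwoMatchings (N : ℕ) : Set where
  field
    active   : Subset N
    s        : Fin N → Fin N
    s-active : ∀ {v} → v ∈ active → s v ∈ active
    s-invol  : ∀ {v} → v ∈ active → s (s v) ≡ v
    s-irrefl : ∀ {v} → v ∈ active → s v ≢ v
    m        : Fin N → Maybe (Fin N)
    m-active : ∀ {v w} → m v ≡ just w → v ∈ active
    m-sym    : ∀ {v w} → m v ≡ just w → m w ≡ just v
    m-irrefl : ∀ {v w} → m v ≡ just w → w ≢ v

  ProperColouring : (Fin N → Bool) → Set
  ProperColouring c =
    (∀ {v} → v ∈ active → c v ≢ c (s v)) × (∀ {v w} → m v ≡ just w → c v ≢ c w)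

  s-swap : ∀ {v w} → v ∈ active → s v ≡ w → v ≡ s w
  s-swap v∈ refl = sym (s-invol v∈)

  m-functional : ∀ {v w w'} → m v ≡ just w → m v ≡ just w' → w ≡ w'
  m-functional mv≡w mv≡w' = just-injective (trans (sym mv≡w) mv≡w')

  m-injective : ∀ {v v' w} → m v ≡ just w → m v' ≡ just w → v ≡ v'
  m-injective mv≡w mv'≡w = m-functional (m-sym mv≡w) (m-sym mv'≡w)

  inactive⇒proper : Empty active → ∀ c → ProperColouring c
  inactive⇒proper empty c =
    (λ v∈ → ⊥-elim (empty (_ , v∈))) , (λ e → ⊥-elim (empty (_ , m-active e)))

-- Delete an s-edge u u' and replace a path a ─m─ u ─s─ u' ─m─ b by an m-edge a ─ b.
module Contraction {N} (X : TwoMatchings N) {u} (u∈ : u ∈ TwoMatchings.active X) where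
  open TwoMatchings X

  u' : Fin N
  u' = s u

  u'≢u : u' ≢ u
  u'≢u = s-irrefl u∈

  Elsewhere : Fin N → Set
  Elsewhere v = v ≢ u × v ≢ u'

  data Position (v : Fin N) : Set where
    at-u      : v ≡ u → Position v
    at-u'     : v ≡ u' → Position v
    elsewhere : Elsewhere v → Position v

  position : ∀ v → Position v
  position v with v ≟ u | v ≟ u'
  ... | yes v≡u | _        = at-u v≡u
  ... | no _    | yes v≡u' = at-u' v≡u'
  ... | no v≢u  | no v≢u'  = elsewhere (v≢u , v≢u')

  byPosition : {A : Set} → A → A → (Fin N → A) → Fin N → A
  byPosition a a' f v with position v
  ... | at-u _      = a
  ... | at-u' _     = a'
  ... | elsewhere _ = f v

  module _ {A : Set} {a a' : A} {f : Fin N → A} where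

    byPosition-u : byPosition a a' f u ≡ a
    byPosition-u with position u
    ... | at-u _            = refl
    ... | at-u' u≡u'        = contradiction (sym u≡u') u'≢u
    ... | elsewhere (u≢u , _) = contradiction refl u≢u

    byPosition-u' : byPosition a a' f u' ≡ a'
    byPosition-u' with position u'
    ... | at-u u'≡u           = contradiction u'≡u u'≢u
    ... | at-u' _             = refl
    ... | elsewhere (_ , u'≢u') = contradiction refl u'≢u'

    byPosition-elsewhere : ∀ {v} → Elsewhere v → byPosition a a' f v ≡ f v
    byPosition-elsewhere {v} (v≢u , v≢u') with position v
    ... | at-u v≡u    = contradiction v≡u v≢u
    ... | at-u' v≡u'  = contradiction v≡u' v≢u'
    ... | elsewhere _ = refl

  active' : Subset N
  active' = active - u - u'

  ∈active'⁺ : ∀ {v} → v ∈ active → Elsewhere v → v ∈ active'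
  ∈active'⁺ v∈ (v≢u , v≢u') = x∈p∧x≢y⇒x∈p-y (x∈p∧x≢y⇒x∈p-y v∈ v≢u) v≢u'

  ∈active'⁻ : ∀ {v} → v ∈ active' → v ∈ active × Elsewhere v
  ∈active'⁻ {v} v∈'' =
    v∈ , (λ { refl → x∉p-x active u v∈' }) , (λ { refl → x∉p-x (active - u) u' v∈'' })
    where
    v∈' : v ∈ active - u
    v∈' = p─q⊆p (active - u) ⁅ u' ⁆ v∈''
    v∈ : v ∈ active
    v∈ = p─q⊆p active ⁅ u ⁆ v∈'

  ∣active'∣<∣active∣ : ∣ active' ∣ < ∣ active ∣
  ∣active'∣<∣active∣ = ≤-<-trans (∣p─q∣≤∣p∣ (active - u) ⁅ u' ⁆) (x∈p⇒∣p-x∣<∣p∣ u∈)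

  s-elsewhere : ∀ {v} → v ∈ active → Elsewhere v → Elsewhere (s v)
  s-elsewhere v∈ (v≢u , v≢u') =
    (λ sv≡u → v≢u' (s-swap v∈ sv≡u)) ,
    (λ sv≡u' → v≢u (trans (s-swap v∈ sv≡u') (s-invol u∈)))

  redirect : Fin N → Maybe (Fin N)
  redirect = byPosition (m u') (m u) just

  m' : Fin N → Maybe (Fin N)
  m' = byPosition nothing nothing (λ v → m v >>= redirect)

  data Contracted (v w : Fin N) : Set where
    kept    : m v ≡ just w → Elsewhere w → Contracted v w
    bridge  : m v ≡ just u → m u' ≡ just w → Contracted v w
    bridge' : m v ≡ just u' → m u ≡ just w → Contracted v w

  m'-just⁺ : ∀ {v w} → Elsewhere v → Contracted v w → m' v ≡ just w
  m'-just⁺ {v} {w} v-else c = trans (byPosition-elsewhere v-else) (via c)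
    where
    via : Contracted v w → (m v >>= redirect) ≡ just w
    via (kept    mv≡w w-else) rewrite mv≡w = byPosition-elsewhere w-else
    via (bridge  mv≡u mu'≡w)  rewrite mv≡u = trans byPosition-u mu'≡w
    via (bridge' mv≡u' mu≡w)  rewrite mv≡u' = trans byPosition-u' mu≡w

  m'-just⁻ : ∀ {v w} → m' v ≡ just w → Elsewhere v × Contracted v w
  m'-just⁻ {v} {w} e with position v
  ... | elsewhere v-else = v-else , via (m v) refl e
    where
    via : ∀ x → m v ≡ x → (x >>= redirect) ≡ just w → Contracted v w
    via (just x) mv≡x e' with position x
    via (just x) mv≡u  e' | at-u refl = bridge mv≡u e'
    via (just x) mv≡u' e' | at-u' refl = bridge' mv≡u' e'
    via (just x) mv≡x refl | elsewhere x-else = kept mv≡x x-else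

  Contracted-active : ∀ {v w} → Contracted v w → v ∈ active
  Contracted-active (kept    mv≡w _) = m-active mv≡w
  Contracted-active (bridge  mv≡u _) = m-active mv≡u
  Contracted-active (bridge' mv≡u' _) = m-active mv≡u'

  Contracted-sym : ∀ {v w} → Elsewhere v → Contracted v w → Elsewhere w × Contracted w v
  Contracted-sym v-else (kept mv≡w w-else) = w-else , kept (m-sym mv≡w) v-else
  Contracted-sym (_ , v≢u') (bridge mv≡u mu'≡w) =
    ((λ { refl → v≢u' (m-injective mv≡u mu'≡w) }) , m-irrefl mu'≡w) ,
    bridge' (m-sym mu'≡w) (m-sym mv≡u)
  Contracted-sym (v≢u , _) (bridge' mv≡u' mu≡w) =
    (m-irrefl mu≡w , (λ { refl → v≢u (m-injective mv≡u' mu≡w) })) ,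
    bridge (m-sym mu≡w) (m-sym mv≡u')

  Contracted-irrefl : ∀ {v w} → Contracted v w → w ≢ v
  Contracted-irrefl (kept    mv≡w _)           = m-irrefl mv≡w
  Contracted-irrefl (bridge  mv≡u mu'≡v)  refl = u'≢u (m-functional (m-sym mu'≡v) mv≡u)
  Contracted-irrefl (bridge' mv≡u' mu≡v)  refl = u'≢u (m-functional mv≡u' (m-sym mu≡v))

  contracted : TwoMatchings N
  contracted = record
    { active   = active'
    ; s        = s
    ; s-active = λ v∈' → let v∈ , v-else = ∈active'⁻ v∈' in
                         ∈active'⁺ (s-active v∈) (s-elsewhere v∈ v-else)
    ; s-invol  = λ v∈ → s-invol (proj₁ (∈active'⁻ v∈))
    ; s-irrefl = λ v∈ → s-irrefl (proj₁ (∈active'⁻ v∈))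
    ; m        = m'
    ; m-active = λ e → let v-else , c = m'-just⁻ e in ∈active'⁺ (Contracted-active c) v-else
    ; m-sym    = λ e → let v-else , c = m'-just⁻ e ; w-else , c' = Contracted-sym v-else c in
                       m'-just⁺ w-else c'
    ; m-irrefl = λ e → Contracted-irrefl (proj₂ (m'-just⁻ e))
    }

  -- u takes the colour opposite to its m-neighbour a, so u' gets the colour of a,
  -- which differs from that of b because a ─ b is an edge of the contraction.
  module Lift (c' : Fin N → Bool) (proper' : TwoMatchings.ProperColouring contracted c') where

    cu : Bool
    cu = maybe (not ∘ c') (maybe c' true (m u')) (m u)

    c : Fin N → Bool
    c = byPosition cu (not cu) c'

    c-u : c u ≡ cu
    c-u = byPosition-u

    c-u' : c u' ≡ not cu
    c-u' = byPosition-u'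

    c-elsewhere : ∀ {v} → Elsewhere v → c v ≡ c' v
    c-elsewhere = byPosition-elsewhere

    c-u≢c-u' : c u ≢ c u'
    c-u≢c-u' cu≡cu' = not-¬ c-u (trans cu≡cu' c-u')

    cu-matched : ∀ {a} → m u ≡ just a → cu ≡ not (c' a)
    cu-matched mu≡a rewrite mu≡a = refl

    cu-unmatched : ∀ {b} → m u ≡ nothing → m u' ≡ just b → cu ≡ c' b
    cu-unmatched mu≡∅ mu'≡b rewrite mu≡∅ | mu'≡b = refl

    s-proper-at : ∀ {v} → v ∈ active → Position v → c v ≢ c (s v)
    s-proper-at _  (at-u refl)  = c-u≢c-u'
    s-proper-at _  (at-u' refl) cu'≡csu' = c-u≢c-u' (sym (trans cu'≡csu' (cong c (s-invol u∈))))
    s-proper-at v∈ (elsewhere v-else) cv≡csv = proj₁ proper' (∈active'⁺ v∈ v-else)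
      (trans (sym (c-elsewhere v-else)) (trans cv≡csv (c-elsewhere (s-elsewhere v∈ v-else))))

    u-edge : ∀ {w} → m u ≡ just w → Position w → c u ≢ c w
    u-edge mu≡u (at-u refl)  = contradiction refl (m-irrefl mu≡u)
    u-edge _    (at-u' refl) = c-u≢c-u'
    u-edge mu≡w (elsewhere w-else) cu≡cw =
      not-¬ refl
        (trans (sym (c-elsewhere w-else)) (trans (sym cu≡cw) (trans c-u (cu-matched mu≡w))))

    u'-edge : ∀ {w} → m u' ≡ just w → Position w → c u' ≢ c w
    u'-edge _      (at-u refl)  = ≢-sym c-u≢c-u'
    u'-edge mu'≡u' (at-u' refl) = contradiction refl (m-irrefl mu'≡u')
    u'-edge {w} mu'≡w (elsewhere w-else) = by-m-u (m u) refl
      where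
      by-m-u : ∀ x → m u ≡ x → c u' ≢ c w
      by-m-u (just a) mu≡a cu'≡cw =
        proj₂ proper' (m'-just⁺ a-else (bridge (m-sym mu≡a) mu'≡w))
          (trans c'a≡cu' (trans cu'≡cw (c-elsewhere w-else)))
        where
        a-else : Elsewhere a
        a-else = m-irrefl mu≡a , λ { refl → proj₁ w-else (m-functional mu'≡w (m-sym mu≡a)) }
        c'a≡cu' : c' a ≡ c u'
        c'a≡cu' = sym (trans c-u' (trans (cong not (cu-matched mu≡a)) (not-involutive (c' a))))
      by-m-u nothing mu≡∅ cu'≡cw =
        not-¬ refl (trans (sym (c-elsewhere w-else))
                          (trans (sym cu'≡cw) (trans c-u' (cong not (cu-unmatched mu≡∅ mu'≡w)))))

    m-proper-at : ∀ {v w} → m v ≡ just w → Position v → Position w → c v ≢ c w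
    m-proper-at mu≡w  (at-u refl)  w-pos = u-edge mu≡w w-pos
    m-proper-at mu'≡w (at-u' refl) w-pos = u'-edge mu'≡w w-pos
    m-proper-at mv≡u  v-pos@(elsewhere _) (at-u refl)  = ≢-sym (u-edge (m-sym mv≡u) v-pos)
    m-proper-at mv≡u' v-pos@(elsewhere _) (at-u' refl) = ≢-sym (u'-edge (m-sym mv≡u') v-pos)
    m-proper-at mv≡w  (elsewhere v-else) (elsewhere w-else) cv≡cw =
      proj₂ proper' (m'-just⁺ v-else (kept mv≡w w-else))
        (trans (sym (c-elsewhere v-else)) (trans cv≡cw (c-elsewhere w-else)))

  lift : ∃ (TwoMatchings.ProperColouring contracted) → ∃ ProperColouring
  lift (c' , proper') =
    c , (λ {v} v∈ → s-proper-at v∈ (position v)) ,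
        (λ {v w} e → m-proper-at e (position v) (position w))
    where open Lift c' proper'

colourable-acc : ∀ {N} (X : TwoMatchings N) → Acc _<_ ∣ TwoMatchings.active X ∣ →
                 ∃ (TwoMatchings.ProperColouring X)
colourable-acc X (acc rec) with nonempty? (TwoMatchings.active X)
... | no empty      = const true , TwoMatchings.inactive⇒proper X empty (const true)
... | yes (u , u∈) = lift (colourable-acc contracted (rec ∣active'∣<∣active∣))
  where open Contraction X u∈

colourable : ∀ {N} (X : TwoMatchings N) → ∃ (TwoMatchings.ProperColouring X)
colourable X = colourable-acc X (<-wellFounded _)

triangle : ∀ {n} → Subset (n * 3) → Fin n → Subset 3
triangle p i = tabulate (λ j → lookup p (combine i j))

module _ {n} {p : Subset (n * 3)} {i : Fin n} {j : Fin 3} where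

  private
    lookup-triangle : lookup (triangle p i) j ≡ lookup p (combine i j)
    lookup-triangle = lookup∘tabulate (λ j → lookup p (combine i j)) j

  ∈-triangle⁺ : combine i j ∈ p → j ∈ triangle p i
  ∈-triangle⁺ ij∈p = lookup⇒[]= j _ (trans lookup-triangle ([]=⇒lookup ij∈p))

  ∈-triangle⁻ : j ∈ triangle p i → combine i j ∈ p
  ∈-triangle⁻ j∈ = lookup⇒[]= (combine i j) p (trans (sym lookup-triangle) ([]=⇒lookup j∈))

-- The first triangle of x ∷ y ∷ z ∷ p is x ∷ y ∷ z ∷ [] and its other triangles
-- are those of p, both definitionally.
meets-every-triangle⇒n≤∣p∣ : ∀ {n} (p : Subset (n * 3)) →
                             (∀ (i : Fin n) → Nonempty (triangle p i)) → n ≤ ∣ p ∣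
meets-every-triangle⇒n≤∣p∣ {zero}  []                meets = z≤n
meets-every-triangle⇒n≤∣p∣ {suc n} (x ∷ y ∷ z ∷ p) meets =
  subst (suc n ≤_) (sym (∣p++q∣≡∣p∣+∣q∣ (x ∷ y ∷ z ∷ []) p))
    (+-mono-≤ (x∈p⇒1≤∣p∣ (proj₂ (meets 0F))) (meets-every-triangle⇒n≤∣p∣ {n} p (meets ∘ suc)))

∣triangle∣≤1⇒∣p∣≤n : ∀ {n} (p : Subset (n * 3)) → (∀ (i : Fin n) → ∣ triangle p i ∣ ≤ 1) → ∣ p ∣ ≤ n
∣triangle∣≤1⇒∣p∣≤n {zero}  []                _     = z≤n
∣triangle∣≤1⇒∣p∣≤n {suc n} (x ∷ y ∷ z ∷ p) atMost =
  subst (_≤ suc n) (sym (∣p++q∣≡∣p∣+∣q∣ (x ∷ y ∷ z ∷ []) p))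
    (+-mono-≤ (atMost 0F) (∣triangle∣≤1⇒∣p∣≤n {n} p (atMost ∘ suc)))

misses-triangle⇒∣p∣<n : ∀ {n} (p : Subset (n * 3)) → (∀ (i : Fin n) → ∣ triangle p i ∣ ≤ 1) →
        ∀ (i : Fin n) → Empty (triangle p i) → ∣ p ∣ < n
misses-triangle⇒∣p∣<n {suc n} (x ∷ y ∷ z ∷ p) atMost 0F missed =
  subst (_< suc n)
    (sym (trans (∣p++q∣≡∣p∣+∣q∣ (x ∷ y ∷ z ∷ []) p) (cong (_+ ∣ p ∣) (Empty⇒∣p∣≡0 missed))))
    (s≤s (∣triangle∣≤1⇒∣p∣≤n {n} p (atMost ∘ suc)))
misses-triangle⇒∣p∣<n {suc n} (x ∷ y ∷ z ∷ p) atMost (suc i) missed =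
  subst (_< suc n) (sym (∣p++q∣≡∣p∣+∣q∣ (x ∷ y ∷ z ∷ []) p))
    (+-mono-≤-< (atMost 0F) (misses-triangle⇒∣p∣<n {n} p (atMost ∘ suc) i missed))

module _ {n} (G : TGraph n) where
  open TGraph G

  corner : Fin (n * 3) → Fin 3
  corner = remainder {n} 3

  tri-combine : ∀ (i : Fin n) (j : Fin 3) → tri (combine i j) ≡ i
  tri-combine i j = cong proj₁ (remQuot-combine i j)

  corner-combine : ∀ (i : Fin n) (j : Fin 3) → corner (combine i j) ≡ j
  corner-combine i j = cong proj₂ (remQuot-combine i j)

  combine-tri-corner : ∀ v → combine (tri v) (corner v) ≡ v
  combine-tri-corner = combine-remQuot {n} 3

  corners-adjacent : ∀ {i : Fin n} {j k : Fin 3} → j ≢ k → Adj (combine i j) (combine i k)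
  corners-adjacent {i} {j} {k} j≢k =
    tri-edge (trans (tri-combine i j) (sym (tri-combine i k))) (j≢k ∘ combine-injectiveʳ i j i k)

  independent⇒∣triangle∣≤1 : ∀ {p} → Independent p → ∀ (i : Fin n) → ∣ triangle p i ∣ ≤ 1
  independent⇒∣triangle∣≤1 indep i = ∣p∣≤1 λ {j} {k} j∈ k∈ →
    decidable-stable (j ≟ k) λ j≢k →
      indep _ _ (∈-triangle⁻ {i = i} j∈) (∈-triangle⁻ {i = i} k∈) (corners-adjacent j≢k)

  module Survivors (removed : Fin n → Fin 3) where

    Survives : Fin (n * 3) → Set
    Survives v = corner v ≢ removed (tri v)

    survives? : Decidable Survives
    survives? v = ¬? (corner v ≟ removed (tri v))

    partner : Fin (n * 3) → Fin (n * 3)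
    partner v = combine (tri v) (other (corner v) (removed (tri v)))

    tri-partner : ∀ v → tri (partner v) ≡ tri v
    tri-partner v = tri-combine (tri v) _

    corner-partner : ∀ v → corner (partner v) ≡ other (corner v) (removed (tri v))
    corner-partner v = corner-combine (tri v) _

    partner-survives : ∀ {v} → Survives v → Survives (partner v)
    partner-survives {v} sv rewrite tri-partner v | corner-partner v = other-≢ʳ _ _ sv

    partner-involutive : ∀ {v} → Survives v → partner (partner v) ≡ v
    partner-involutive {v} sv
      rewrite tri-partner v | corner-partner v | other-involutive (corner v) (removed (tri v)) sv
      = combine-tri-corner v

    partner-irrefl : ∀ {v} → Survives v → partner v ≢ v
    partner-irrefl {v} sv pv≡v = other-≢ˡ _ _ sv (trans (sym (corner-partner v)) (cong corner pv≡v))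

    tri-edge⇒partner : ∀ {u v} → Survives u → Survives v → tri u ≡ tri v → u ≢ v → v ≡ partner u
    tri-edge⇒partner {u} {v} su sv same u≢v = begin
      v                          ≡⟨ combine-tri-corner v ⟨
      combine (tri v) (corner v) ≡⟨ cong₂ combine (sym same) corner-v ⟩
      partner u                  ∎
      where
      open ≡-Reasoning
      corner-v : corner v ≡ other (corner u) (removed (tri u))
      corner-v = other-unique _ _ _ su
        (λ cv≡cu → u≢v (begin
          u                          ≡⟨ combine-tri-corner u ⟨
          combine (tri u) (corner u) ≡⟨ cong₂ combine same (sym cv≡cu) ⟩
          combine (tri v) (corner v) ≡⟨ combine-tri-corner v ⟩
          v                          ∎))
        (λ cv≡r → sv (trans cv≡r (cong removed same)))

    match : Fin (n * 3) → Maybe (Fin (n * 3))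
    match v with survives? v ×-dec survives? (M v)
    ... | yes _ = just (M v)
    ... | no _  = nothing

    match-just⁺ : ∀ {v} → Survives v → Survives (M v) → match v ≡ just (M v)
    match-just⁺ {v} sv sMv with survives? v ×-dec survives? (M v)
    ... | yes _ = refl
    ... | no ¬both = contradiction (sv , sMv) ¬both

    match-just⁻ : ∀ {v w} → match v ≡ just w → (Survives v × Survives (M v)) × M v ≡ w
    match-just⁻ {v} e with survives? v ×-dec survives? (M v)
    match-just⁻ refl | yes both = both , refl

    survivors : TwoMatchings (n * 3)
    survivors = record
      { active   = subsetOf survives?
      ; s        = partner
      ; s-active = λ v∈ → ∈-subsetOf⁺ survives? (partner-survives (∈-subsetOf⁻ survives? v∈))
      ; s-invol  = λ v∈ → partner-involutive (∈-subsetOf⁻ survives? v∈)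
      ; s-irrefl = λ v∈ → partner-irrefl (∈-subsetOf⁻ survives? v∈)
      ; m        = match
      ; m-active = λ e → ∈-subsetOf⁺ survives? (proj₁ (proj₁ (match-just⁻ e)))
      ; m-sym    = λ e → match-sym (match-just⁻ e)
      ; m-irrefl = λ e w≡v → M-other _ (cong tri (trans (proj₂ (match-just⁻ e)) w≡v))
      }
      where
      match-sym : ∀ {v w} → (Survives v × Survives (M v)) × M v ≡ w → match w ≡ just v
      match-sym {v} ((sv , sMv) , refl) =
        trans (match-just⁺ sMv (subst Survives (sym (M-invol v)) sv)) (cong just (M-invol v))

    survivors-colourable : ∃ λ c → ∀ {u v} → Survives u → Survives v → Adj u v → c u ≢ c v
    survivors-colourable = c , proper
      where
      c : Fin (n * 3) → Bool
      c = proj₁ (colourable survivors)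

      proper : ∀ {u v} → Survives u → Survives v → Adj u v → c u ≢ c v
      proper su sv (tri-edge same u≢v) rewrite tri-edge⇒partner su sv same u≢v =
        proj₁ (proj₂ (colourable survivors)) (∈-subsetOf⁺ survives? su)
      proper su sv (match-edge refl) = proj₂ (proj₂ (colourable survivors)) (match-just⁺ su sv)

  independent-transversal : ∃ λ T → Independent T × (∀ (i : Fin n) → Nonempty (triangle T i))
  independent-transversal = T , T-independent , T-meets
    where
    open Survivors (const 0F)

    c : Fin (n * 3) → Bool
    c = proj₁ survivors-colourable

    proper : ∀ {u v} → Survives u → Survives v → Adj u v → c u ≢ c v
    proper = proj₂ survivors-colourable

    Chosen : Fin (n * 3) → Set
    Chosen v = Survives v × c v ≡ true

    chosen? : Decidable Chosen
    chosen? v = survives? v ×-dec c v ≟ᴮ true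

    T : Subset (n * 3)
    T = subsetOf chosen?

    T-independent : Independent T
    T-independent u v u∈ v∈ u~v with ∈-subsetOf⁻ chosen? u∈ | ∈-subsetOf⁻ chosen? v∈
    ... | su , cu≡true | sv , cv≡true = proper su sv u~v (trans cu≡true (sym cv≡true))

    corner-survives : ∀ {i : Fin n} {j : Fin 3} → j ≢ 0F → Survives (combine i j)
    corner-survives {i} {j} j≢0 = j≢0 ∘ trans (sym (corner-combine i j))

    T-meets : ∀ (i : Fin n) → Nonempty (triangle T i)
    T-meets i with c (combine i 1F) in c₁ | c (combine i 2F) in c₂
    ... | true  | _     = 1F , ∈-triangle⁺ {i = i} (∈-subsetOf⁺ chosen? (corner-survives (λ ()) , c₁))
    ... | false | true  = 2F , ∈-triangle⁺ {i = i} (∈-subsetOf⁺ chosen? (corner-survives (λ ()) , c₂))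
    ... | false | false = contradiction (trans c₁ (sym c₂))
      (proper (corner-survives (λ ())) (corner-survives (λ ())) (corners-adjacent (λ ())))

  maximum⇒meets-every-triangle : ∀ {S} → MaximumIndependent S →
                                 ∀ (i : Fin n) → Nonempty (triangle S i)
  maximum⇒meets-every-triangle {S} (S-independent , S-maximum) i with nonempty? (triangle S i)
  ... | yes meets  = meets
  ... | no  missed = contradiction n≤∣S∣ (<⇒≱ ∣S∣<n)
    where
    ∣S∣<n : ∣ S ∣ < n
    ∣S∣<n = misses-triangle⇒∣p∣<n S (independent⇒∣triangle∣≤1 S-independent) i missed

    n≤∣S∣ : n ≤ ∣ S ∣
    n≤∣S∣ = let T , T-independent , T-meets = independent-transversal
            in ≤-trans (meets-every-triangle⇒n≤∣p∣ T T-meets) (S-maximum T T-independent)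

lemma2 : (n : ℕ) (G : TGraph n) (S : Subset (n * 3)) →
         TGraph.MaximumIndependent G S → TGraph.BipartiteMinus G S
lemma2 n G S S-maximum = c , λ u v u∉S v∉S → proper (survives u∉S) (survives v∉S)
  where
  open TGraph G

  meets : ∀ i → Nonempty (triangle S i)
  meets = maximum⇒meets-every-triangle G S-maximum

  open Survivors G (λ i → proj₁ (meets i))

  c : Fin (n * 3) → Bool
  c = proj₁ survivors-colourable

  proper : ∀ {u v} → Survives u → Survives v → Adj u v → c u ≢ c v
  proper = proj₂ survivors-colourable

  survives : ∀ {u} → u ∉ S → Survives u
  survives {u} u∉S corner≡removed = u∉S (subst (_∈ S)
    (trans (cong (combine (tri u)) (sym corner≡removed)) (combine-tri-corner G u))
    (∈-triangle⁻ {i = tri u} (proj₂ (meets (tri u)))))
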